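{- Let $t \ge 3$ be odd, $n_1 \ge 3$, and $n_2 = 4^\ell s$ for some integer $\ell \ge 0$ and odd integer $s \ge 1$. Assume that both $K_{n_1[t]}^*$ and $K_{n_2[t]}^*$ admit $\vec{C}_t$-factorizations. Then $K_{n_1 n_2[t]}^*$ admits a $\vec{C}_t$-factorization.
   Context: $K_{n[m]}^*$ denotes the complete symmetric equipartite digraph with $n$ parts of size $m$: vertex set partitioned into $n$ parts of size $m$, with $(u,v)$ an arc if and only if $u,v$ lie in different parts. $\vec{C}_t$ is the directed cycle of length $t$. A $\vec{C}_t$-factor of a digraph $D$ is a spanning subdigraph that is a disjoint union of directed $t$-cycles; a $\vec{C}_t$-factorization of $D$ is a set of $\vec{C}_t$-factors whose arc sets partition $A(D)$. -}

module Defs where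

open import Data.Nat using (ℕ; zero; suc; _<_; _*_; _^_)
open import Data.Fin using (Fin)
open import Data.Product using (Σ; _×_; _,_; ∃)
open import Relation.Binary.PropositionalEquality using (_≡_)
open import Relation.Nullary using (¬_)
open import Function.Definitions using (Bijective)

-- Vertices of K*_{n[m]}: pairs (part, index within part).
Vertex : ℕ → ℕ → Set
Vertex n m = Fin n × Fin m

part : ∀ {n m} → Vertex n m → Fin n
part (p , _) = p

Arc : (n m : ℕ) → Vertex n m → Vertex n m → Set
Arc n m u v = ¬ (part u ≡ part v)

iter : ∀ {A : Set} → ℕ → (A → A) → A → A
iter zero    f x = x
iter (suc k) f x = f (iter k f x)

-- A spanning subdigraph in which every vertex has in- and out-degree 1 is
-- given by its successor map σ (the arcs are (v , σ v)); σ is a bijection.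
record CtFactor (t n m : ℕ) : Set where
  field
    succ      : Vertex n m → Vertex n m
    bijective : Bijective _≡_ _≡_ succ
    arcs-in   : ∀ v → Arc n m v (succ v)
    closes    : ∀ v → iter t succ v ≡ v
    minimal   : ∀ v i → 0 < i → i < t → ¬ (iter i succ v ≡ v)

open CtFactor public

record CtFactorization (t n m : ℕ) : Set where
  field
    size    : ℕ
    factor  : Fin size → CtFactor t n m
    covers  : ∀ u v → Arc n m u v → ∃ λ j → succ (factor j) u ≡ v
    disjoint : ∀ u v (j j′ : Fin size) →
               succ (factor j) u ≡ v → succ (factor j′) u ≡ v → j ≡ j′

HasCtFactorization : (t n m : ℕ) → Set
HasCtFactorization t n m = CtFactorization t n m

-- The vertices of K*_{n₁n₂[m]} are triples ((i , x) , y), where (i , x) is a vertex of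
-- K*_{n₁[m]} and y ∈ Fin n₂; an arc either changes the block i or keeps i and changes y.
-- Arcs inside a block are covered by n₁ copies of the factors of K*_{n₂[m]}. For the arcs
-- between blocks, take a factor σ of K*_{n₁[m]}, a proper 3-colouring c of its cycles (t ≥ 2)
-- and d ∈ Fin n₂, and send (a , y) to (σ a , π (c (σ a)) d (π (c a) d ⁻¹ y)), where π is an
-- orthogonal triple on Fin n₂. This permutation is conjugate to σ × id, so it is again a
-- C_t-factor, and because for c ≠ c′ the maps d ↦ π c′ d ∘ π c d ⁻¹ are sharply transitive,
-- every arc between blocks lies in exactly one of these factors. Orthogonal triples exist on
-- ℤ/sℤ for odd s (multipliers 0, 1, 2), on GF(4) (multipliers 0, 1, ω) and on products, hence
-- on Fin (4 ^ ℓ * s).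
module Submission where

open import Data.Empty using (⊥-elim)
open import Data.Fin using (Fin; toℕ)
open import Data.Fin.Patterns using (0F; 1F; 2F; 3F)
open import Data.Fin.Properties using (*↔×; +↔⊎; toℕ-injective; toℕ-fromℕ<; toℕ<n; all?; any?; _≟_)
open import Data.List using (upTo)
open import Data.List.Extrema.Nat using (argmin; argmin-all; f[argmin]≤f[xs])
open import Data.List.Membership.Propositional.Properties using (∈-upTo⁺)
import Data.List.Relation.Unary.All as All
open import Data.List.Relation.Unary.All.Properties using (all-upTo)
open import Data.Nat using (ℕ; zero; suc; _+_; _*_; _^_; _∸_; _%_; _≤_; _<_; z≤n; s≤s; s≤s⁻¹)
open import Data.Nat.DivMod using (_mod_; %-distribˡ-+; %-distribˡ-*; m%n%n≡m%n; [m+kn]%n≡m%n; m%n<n; m<n⇒m%n≡m)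
open import Data.Nat.Properties using (+-comm; *-comm; <-cmp; m∸n+n≡m; <⇒≤; m<n⇒0<n∸m; m∸n≤m; <-≤-trans; <-trans; ≤-antisym; ≤-refl; <⇒≱; n<1+n)
open import Data.Nat.Tactic.RingSolver using (solve-∀)
open import Data.Product using (Σ; _×_; _,_; proj₁; proj₂; ∃; map₁)
open import Data.Product.Algebra using (×-cong)
open import Data.Sum using (_⊎_; inj₁; inj₂)
open import Data.Sum.Algebra using (⊎-cong)
open import Function using (_∘_)
open import Function.Bundles using (_↔_; Inverse; Injection; Bijection; mk↔ₛ′; mk⤖)
open import Function.Definitions using (Injective; StrictlySurjective)
open import Function.Properties.Bijection using (⤖⇒↔)
open import Function.Properties.Inverse using (↔-trans; ↔-sym; ↔-refl; ↔⇒↣; ↔⇒⤖)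
open import Level using (0ℓ)
open import Relation.Binary.Bundles using (Setoid)
open import Relation.Binary.Definitions using (tri<; tri≈; tri>)
open import Relation.Binary.PropositionalEquality using (_≡_; _≢_; refl; sym; trans; cong; cong₂; subst; subst₂; module ≡-Reasoning)
open import Relation.Nullary using (¬_; yes; no)
open import Relation.Nullary.Decidable using (from-yes; ¬?; _→-dec_)
open import Defs

open Inverse

to-injective : ∀ {A B : Set} (e : A ↔ B) → Injective _≡_ _≡_ (to e)
to-injective e = Injection.injective (↔⇒↣ e)

iter-+ : ∀ {A : Set} (i j : ℕ) (f : A → A) x → iter (i + j) f x ≡ iter i f (iter j f x)
iter-+ zero    j f x = refl
iter-+ (suc i) j f x = cong f (iter-+ i j f x)

iter-suc : ∀ {A : Set} (i : ℕ) (f : A → A) x → iter i f (f x) ≡ iter (suc i) f x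
iter-suc zero    f x = refl
iter-suc (suc i) f x = cong f (iter-suc i f x)

record ExactPeriod (t : ℕ) {A : Set} (f : A → A) : Set where
  field
    returns      : ∀ a → iter t f a ≡ a
    not-before   : ∀ a i → 0 < i → i < t → iter i f a ≢ a

module _ {V W : Set} (e : V ↔ W) (f : W → W) where

  iter-conjugate : ∀ i v → iter i (from e ∘ f ∘ to e) v ≡ from e (iter i f (to e v))
  iter-conjugate zero    v = sym (strictlyInverseʳ e v)
  iter-conjugate (suc i) v =
    cong (from e ∘ f) (trans (cong (to e) (iter-conjugate i v)) (strictlyInverseˡ e _))

  conjugate-exactPeriod : ∀ {t} → ExactPeriod t f → ExactPeriod t (from e ∘ f ∘ to e)
  conjugate-exactPeriod {t} p = record
    { returns    = λ v → trans (iter-conjugate t v)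
                     (trans (cong (from e) (returns (to e v))) (strictlyInverseʳ e v))
    ; not-before = λ v i 0<i i<t eq → not-before (to e v) i 0<i i<t
                     (trans (sym (strictlyInverseˡ e _))
                       (cong (to e) (trans (sym (iter-conjugate i v)) eq)))
    }
    where open ExactPeriod p

iter-map₁ : ∀ {A B : Set} (f : A → A) i a (b : B) → iter i (map₁ f) (a , b) ≡ (iter i f a , b)
iter-map₁ f zero    a b = refl
iter-map₁ f (suc i) a b = cong (map₁ f) (iter-map₁ f i a b)

map₁-exactPeriod : ∀ {A B : Set} {t} {f : A → A} → ExactPeriod t f → ExactPeriod t (map₁ {C = B} f)
map₁-exactPeriod {t = t} {f} p = record
  { returns    = λ (a , b) → trans (iter-map₁ f t a b) (cong (_, b) (returns a))
  ; not-before = λ (a , b) i 0<i i<t eq →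
      not-before a i 0<i i<t (cong proj₁ (trans (sym (iter-map₁ f i a b)) eq))
  }
  where open ExactPeriod p

module _ {A : Set} {t : ℕ} {f : A → A} (p : ExactPeriod t f) where
  open ExactPeriod p

  private
    iter-distinct : ∀ a {i j} → i < j → j < t → iter i f a ≢ iter j f a
    iter-distinct a {i} {j} i<j j<t eq = not-before (iter i f a) (j ∸ i)
      (m<n⇒0<n∸m i<j) (<-≤-trans (s≤s (m∸n≤m j i)) j<t)
      (begin
        iter (j ∸ i) f (iter i f a) ≡⟨ iter-+ (j ∸ i) i f a ⟨
        iter (j ∸ i + i) f a        ≡⟨ cong (λ k → iter k f a) (m∸n+n≡m (<⇒≤ i<j)) ⟩
        iter j f a                  ≡⟨ eq ⟨
        iter i f a                  ∎)
      where open ≡-Reasoning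

  iter-injective : ∀ a {i j} → i < t → j < t → iter i f a ≡ iter j f a → i ≡ j
  iter-injective a {i} {j} i<t j<t eq with <-cmp i j
  ... | tri< i<j _ _ = ⊥-elim (iter-distinct a i<j j<t eq)
  ... | tri≈ _ i≡j _ = i≡j
  ... | tri> _ _ j<i = ⊥-elim (iter-distinct a j<i i<t (sym eq))

-- Proper 3-colourings

alternate : ℕ → Fin 3
alternate zero          = 0F
alternate (suc zero)    = 1F
alternate (suc (suc k)) = alternate k

alternate-suc : ∀ k → alternate (suc k) ≢ alternate k
alternate-suc zero          ()
alternate-suc (suc zero)    ()
alternate-suc (suc (suc k)) = alternate-suc k

alternate≢2 : ∀ k → alternate k ≢ 2F
alternate≢2 zero          ()
alternate≢2 (suc zero)    ()
alternate≢2 (suc (suc k)) = alternate≢2 k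

positionColour : ℕ → Fin 3
positionColour zero    = 2F
positionColour (suc k) = alternate k

positionColour-suc : ∀ k → positionColour k ≢ positionColour (suc k)
positionColour-suc zero    = λ ()
positionColour-suc (suc k) = λ eq → alternate-suc k (sym eq)

-- a is coloured by its distance along f to the element of least code in its orbit. This
-- distance drops by one at each step, except that it wraps around from 0 to t − 1 ≥ 1.
module ThreeColouring {A : Set} (code : A → ℕ) (code-injective : Injective _≡_ _≡_ code)
  {t′ : ℕ} {f : A → A} (p : ExactPeriod (2 + t′) f) where

  open ExactPeriod p

  private
    t : ℕ
    t = 2 + t′

    orbitCode : A → ℕ → ℕ
    orbitCode a i = code (iter i f a)

  private abstract
    stepsToMin : A → ℕ
    stepsToMin a = argmin (orbitCode a) 0 (upTo t)

    stepsToMin<t : ∀ a → stepsToMin a < t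
    stepsToMin<t a = argmin-all (orbitCode a) (s≤s z≤n) (all-upTo t)

    stepsToMin-minimal : ∀ a {i} → i < t → orbitCode a (stepsToMin a) ≤ orbitCode a i
    stepsToMin-minimal a i<t = All.lookup (f[argmin]≤f[xs] {f = orbitCode a} 0 (upTo t)) (∈-upTo⁺ i<t)

  private
    minimum-of-successor : ∀ a {i} → i < t → orbitCode a (stepsToMin a) ≤ orbitCode (f a) i
    minimum-of-successor a {i} i<t with <-cmp (suc i) t
    ... | tri< 1+i<t _ _ = subst (orbitCode a (stepsToMin a) ≤_) (cong code (sym (iter-suc i f a)))
                             (stepsToMin-minimal a 1+i<t)
    ... | tri≈ _ refl _ = subst (orbitCode a (stepsToMin a) ≤_) (cong code (sym (trans (iter-suc i f a) (returns a))))
                             (stepsToMin-minimal a (s≤s z≤n))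
    ... | tri> _ _ t<1+i = ⊥-elim (<⇒≱ i<t (s≤s⁻¹ t<1+i))

    stepsToMin-of-successor : ∀ a {j} → j < t → orbitCode (f a) j ≡ orbitCode a (stepsToMin a) →
                          stepsToMin (f a) ≡ j
    stepsToMin-of-successor a {j} j<t eq = iter-injective p (f a) (stepsToMin<t (f a)) j<t
      (code-injective (≤-antisym
        (stepsToMin-minimal (f a) j<t)
        (subst (_≤ orbitCode (f a) (stepsToMin (f a))) (sym eq) (minimum-of-successor a (stepsToMin<t (f a))))))

    stepsToMin-suc : ∀ a {j} → stepsToMin a ≡ suc j → stepsToMin (f a) ≡ j
    stepsToMin-suc a {j} eq = stepsToMin-of-successor a (<-trans (n<1+n j) (subst (_< t) eq (stepsToMin<t a)))
      (trans (cong code (iter-suc j f a)) (cong (orbitCode a) (sym eq)))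

    stepsToMin-zero : ∀ a → stepsToMin a ≡ 0 → stepsToMin (f a) ≡ suc t′
    stepsToMin-zero a eq = stepsToMin-of-successor a ≤-refl
      (trans (cong code (trans (iter-suc (suc t′) f a) (returns a))) (cong (orbitCode a) (sym eq)))

  colour : A → Fin 3
  colour a = positionColour (stepsToMin a)

  colour-proper : ∀ a → colour (f a) ≢ colour a
  colour-proper a with stepsToMin a in eq
  ... | zero  rewrite stepsToMin-zero a eq = alternate≢2 t′
  ... | suc j rewrite stepsToMin-suc a eq  = positionColour-suc j

-- Orthogonal triples

record OrthogonalTriple (Y : Set) : Set where
  field
    π : Fin 3 → Y → Y ↔ Y
    difference-injective : ∀ {c c′} → c ≢ c′ → ∀ y →
      Injective _≡_ _≡_ (λ d → to (π c′ d) (from (π c d) y))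
    difference-surjective : ∀ {c c′} → c ≢ c′ → ∀ y →
      StrictlySurjective _≡_ (λ d → to (π c′ d) (from (π c d) y))

open OrthogonalTriple

×-orthogonalTriple : ∀ {Y Z} → OrthogonalTriple Y → OrthogonalTriple Z → OrthogonalTriple (Y × Z)
×-orthogonalTriple P Q = record
  { π = λ c (d , e) → ×-cong (π P c d) (π Q c e)
  ; difference-injective = λ c≢c′ (y , z) eq → cong₂ _,_
      (difference-injective P c≢c′ y (cong proj₁ eq))
      (difference-injective Q c≢c′ z (cong proj₂ eq))
  ; difference-surjective = λ c≢c′ (y , z) (y′ , z′) →
      let (d , p) = difference-surjective P c≢c′ y y′
          (e , q) = difference-surjective Q c≢c′ z z′
      in (d , e) , cong₂ _,_ p q
  }

↔-orthogonalTriple : ∀ {Y Z} → Y ↔ Z → OrthogonalTriple Y → OrthogonalTriple Z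
↔-orthogonalTriple {Y} {Z} e P = record
  { π = π′
  ; difference-injective = λ c≢c′ z {d} {d′} eq → to-injective (↔-sym e)
      (difference-injective P c≢c′ (from e z)
        (to-injective e (trans (sym (difference′ _ _ z d)) (trans eq (difference′ _ _ z d′)))))
  ; difference-surjective = λ c≢c′ z z′ →
      let (d , p) = difference-surjective P c≢c′ (from e z) (from e z′)
      in to e d , (begin
        to (π′ _ (to e d)) (from (π′ _ (to e d)) z) ≡⟨ difference′ _ _ z (to e d) ⟩
        to e (to (π P _ (from e (to e d))) (from (π P _ (from e (to e d))) (from e z)))
           ≡⟨ cong (λ d₀ → to e (to (π P _ d₀) (from (π P _ d₀) (from e z)))) (strictlyInverseʳ e d) ⟩
        to e (to (π P _ d) (from (π P _ d) (from e z))) ≡⟨ cong (to e) p ⟩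
        to e (from e z′)                                     ≡⟨ strictlyInverseˡ e z′ ⟩
        z′ ∎)
  }
  where
  π′ : Fin 3 → Z → Z ↔ Z
  π′ c d = ↔-trans (↔-trans (↔-sym e) (π P c (from e d))) e
  difference′ : ∀ c c′ z d → to (π′ c′ d) (from (π′ c d) z)
    ≡ to e (to (π P c′ (from e d)) (from (π P c (from e d)) (from e z)))
  difference′ c c′ z d = cong (to e ∘ to (π P c′ (from e d))) (strictlyInverseʳ e _)
  open ≡-Reasoning

-- GF(4) = {0, 1, ω, ω + 1}, encoded as 0F, 1F, 2F, 3F.
_⊕_ : Fin 4 → Fin 4 → Fin 4
0F ⊕ y  = y
x  ⊕ 0F = x
1F ⊕ 1F = 0F
1F ⊕ 2F = 3F
1F ⊕ 3F = 2F
2F ⊕ 1F = 3F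
2F ⊕ 2F = 0F
2F ⊕ 3F = 1F
3F ⊕ 1F = 2F
3F ⊕ 2F = 1F
3F ⊕ 3F = 0F

ω* : Fin 4 → Fin 4
ω* 0F = 0F
ω* 1F = 2F
ω* 2F = 3F
ω* 3F = 1F

-- multiplication by 0, 1 and ω; their pairwise differences 1, ω, ω + 1 are invertible
gf4-multiplier : Fin 3 → Fin 4 → Fin 4
gf4-multiplier 0F d = 0F
gf4-multiplier 1F d = d
gf4-multiplier 2F d = ω* d

⊕-involutive : ∀ x y → (x ⊕ y) ⊕ y ≡ x
⊕-involutive = from-yes (all? λ x → all? λ y → (x ⊕ y) ⊕ y ≟ x)

gf4-orthogonalTriple : OrthogonalTriple (Fin 4)
gf4-orthogonalTriple = record
  { π = λ c d → mk↔ₛ′ (_⊕ gf4-multiplier c d) (_⊕ gf4-multiplier c d)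
                         (λ y → ⊕-involutive y _) (λ y → ⊕-involutive y _)
  ; difference-injective = λ c≢c′ y eq → injective _ _ c≢c′ y _ _ eq
  ; difference-surjective = surjective _ _
  }
  where
  difference : Fin 3 → Fin 3 → Fin 4 → Fin 4 → Fin 4
  difference c c′ y d = (y ⊕ gf4-multiplier c d) ⊕ gf4-multiplier c′ d
  injective : ∀ c c′ → c ≢ c′ → ∀ y d d′ → difference c c′ y d ≡ difference c c′ y d′ → d ≡ d′
  injective = from-yes (all? λ c → all? λ c′ → ¬? (c ≟ c′) →-dec all? λ y → all? λ d → all? λ d′ →
                (difference c c′ y d ≟ difference c c′ y d′) →-dec (d ≟ d′))
  surjective : ∀ c c′ → c ≢ c′ → ∀ y y′ → ∃ λ d → difference c c′ y d ≡ y′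
  surjective = from-yes (all? λ c → all? λ c′ → ¬? (c ≟ c′) →-dec all? λ y → all? λ y′ →
                 any? λ d → difference c c′ y d ≟ y′)

module Cyclic (b : ℕ) where

  s : ℕ
  s = suc (2 * b)

  infix 4 _≈_
  record _≈_ (x y : ℕ) : Set where
    constructor mod-≡
    field mod-equal : x % s ≡ y % s
  open _≈_

  ≈-setoid : Setoid 0ℓ 0ℓ
  ≈-setoid = record
    { _≈_ = _≈_
    ; isEquivalence = record
      { refl  = mod-≡ refl
      ; sym   = λ p → mod-≡ (sym (mod-equal p))
      ; trans = λ p q → mod-≡ (trans (mod-equal p) (mod-equal q))
      }
    }

  open import Relation.Binary.Reasoning.Setoid ≈-setoid

  %-≈ : ∀ x → x % s ≈ x
  %-≈ x = mod-≡ (m%n%n≡m%n x s)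

  +-multiple-≈ : ∀ x k → x + k * s ≈ x
  +-multiple-≈ x k = mod-≡ ([m+kn]%n≡m%n x k s)

  +-≈ˡ : ∀ x {z z′} → z ≈ z′ → x + z ≈ x + z′
  +-≈ˡ x {z} {z′} (mod-≡ p) = mod-≡ (trans (%-distribˡ-+ x z s)
    (trans (cong (λ v → (x % s + v) % s) p) (sym (%-distribˡ-+ x z′ s))))

  +-≈ʳ : ∀ x {z z′} → z ≈ z′ → z + x ≈ z′ + x
  +-≈ʳ x {z} {z′} p = subst₂ _≈_ (+-comm x z) (+-comm x z′) (+-≈ˡ x p)

  *-≈ˡ : ∀ x {z z′} → z ≈ z′ → x * z ≈ x * z′
  *-≈ˡ x {z} {z′} (mod-≡ p) = mod-≡ (trans (%-distribˡ-* x z s)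
    (trans (cong (λ v → (x % s * v) % s) p) (sym (%-distribˡ-* x z′ s))))

  *-≈ʳ : ∀ x {z z′} → z ≈ z′ → z * x ≈ z′ * x
  *-≈ʳ x {z} {z′} p = subst₂ _≈_ (*-comm x z) (*-comm x z′) (*-≈ˡ x p)

  ≈⇒≡ : ∀ {y y′ : Fin s} → toℕ y ≈ toℕ y′ → y ≡ y′
  ≈⇒≡ {y} {y′} (mod-≡ p) = toℕ-injective (trans (sym (m<n⇒m%n≡m (toℕ<n y))) (trans p (m<n⇒m%n≡m (toℕ<n y′))))

  toℕ-mod-≈ : ∀ x → toℕ (x mod s) ≈ x
  toℕ-mod-≈ x = mod-≡ (trans (cong (_% s) (toℕ-fromℕ< (m%n<n x s))) (mod-equal (%-≈ x)))

  shift : ℕ → Fin s → Fin s → Fin s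
  shift a d y = (toℕ y + a * toℕ d) mod s

  shift-shift : ∀ a a′ (d y : Fin s) → shift a′ d (shift a d y) ≡ shift (a + a′) d y
  shift-shift a a′ d y = ≈⇒≡ (begin
    toℕ (shift a′ d (shift a d y))       ≈⟨ toℕ-mod-≈ _ ⟩
    toℕ (shift a d y) + a′ * toℕ d       ≈⟨ +-≈ʳ (a′ * toℕ d) (toℕ-mod-≈ (toℕ y + a * toℕ d)) ⟩
    toℕ y + a * toℕ d + a′ * toℕ d       ≡⟨ distrib (toℕ y) a a′ (toℕ d) ⟩
    toℕ y + (a + a′) * toℕ d             ≈⟨ toℕ-mod-≈ _ ⟨
    toℕ (shift (a + a′) d y)             ∎)
    where
    distrib : ∀ y a a′ d → y + a * d + a′ * d ≡ y + (a + a′) * d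
    distrib = solve-∀

  shift-multiple : ∀ k (d y : Fin s) → shift (k * s) d y ≡ y
  shift-multiple k d y = ≈⇒≡ (begin
    toℕ (shift (k * s) d y)       ≈⟨ toℕ-mod-≈ _ ⟩
    toℕ y + (k * s) * toℕ d       ≡⟨ cong (toℕ y +_) (swap k s (toℕ d)) ⟩
    toℕ y + (k * toℕ d) * s       ≈⟨ +-multiple-≈ (toℕ y) (k * toℕ d) ⟩
    toℕ y                         ∎)
    where
    swap : ∀ k s d → (k * s) * d ≡ (k * d) * s
    swap = solve-∀

  -- a · reciprocal ≡ 1 (mod s), with the multiples of s moved to both sides
  record Invertible (a : ℕ) : Set where
    constructor invertible
    field
      reciprocal k₁ k₂ : ℕ
      witness          : a * reciprocal + k₁ * s ≡ 1 + k₂ * s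

  inverse-cancels : ∀ {a} (u : Invertible a) x → a * Invertible.reciprocal u * x ≈ x
  inverse-cancels {a} (invertible e k₁ k₂ w) x = begin
    a * e * x               ≈⟨ +-multiple-≈ (a * e * x) (k₁ * x) ⟨
    a * e * x + k₁ * x * s  ≡⟨ collect a e x k₁ s ⟩
    (a * e + k₁ * s) * x    ≡⟨ cong (_* x) w ⟩
    (1 + k₂ * s) * x        ≡⟨ expand x k₂ s ⟩
    x + k₂ * x * s          ≈⟨ +-multiple-≈ x (k₂ * x) ⟩
    x                       ∎
    where
    collect : ∀ a e x k s → a * e * x + k * x * s ≡ (a * e + k * s) * x
    collect = solve-∀
    expand : ∀ x k s → (1 + k * s) * x ≡ x + k * x * s
    expand = solve-∀

  module _ {a : ℕ} (u : Invertible a) (y : Fin s) where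
    open Invertible u

    private
      -- the d with y + a·d = y′
      solve : Fin s → Fin s
      solve y′ = ((toℕ y′ + 2 * b * toℕ y) * reciprocal) mod s

      solve-shift : ∀ d → solve (shift a d y) ≡ d
      solve-shift d = ≈⇒≡ (begin
        toℕ (solve (shift a d y))                  ≈⟨ toℕ-mod-≈ _ ⟩
        (toℕ (shift a d y) + 2 * b * toℕ y) * reciprocal
          ≈⟨ *-≈ʳ reciprocal (+-≈ʳ (2 * b * toℕ y) (toℕ-mod-≈ (toℕ y + a * toℕ d))) ⟩
        (toℕ y + a * toℕ d + 2 * b * toℕ y) * reciprocal ≡⟨ regroup b (toℕ y) a (toℕ d) reciprocal ⟩
        a * reciprocal * toℕ d + toℕ y * reciprocal * s  ≈⟨ +-multiple-≈ _ (toℕ y * reciprocal) ⟩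
        a * reciprocal * toℕ d                        ≈⟨ inverse-cancels u (toℕ d) ⟩
        toℕ d                                      ∎)
        where
        regroup : ∀ b y a d e → (y + a * d + 2 * b * y) * e ≡ a * e * d + y * e * suc (2 * b)
        regroup = solve-∀

      shift-solve : ∀ y′ → shift a (solve y′) y ≡ y′
      shift-solve y′ = ≈⇒≡ (begin
        toℕ (shift a (solve y′) y)              ≈⟨ toℕ-mod-≈ _ ⟩
        toℕ y + a * toℕ (solve y′)              ≈⟨ +-≈ˡ (toℕ y) (*-≈ˡ a (toℕ-mod-≈ X)) ⟩
        toℕ y + a * X                           ≡⟨ cong (toℕ y +_) (reassoc a (toℕ y′ + 2 * b * toℕ y) reciprocal) ⟩
        toℕ y + a * reciprocal * (toℕ y′ + 2 * b * toℕ y)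
          ≈⟨ +-≈ˡ (toℕ y) (inverse-cancels u (toℕ y′ + 2 * b * toℕ y)) ⟩
        toℕ y + (toℕ y′ + 2 * b * toℕ y)        ≡⟨ regroup b (toℕ y) (toℕ y′) ⟩
        toℕ y′ + toℕ y * s                      ≈⟨ +-multiple-≈ (toℕ y′) (toℕ y) ⟩
        toℕ y′                                  ∎)
        where
        X : ℕ
        X = (toℕ y′ + 2 * b * toℕ y) * reciprocal
        reassoc : ∀ a z e → a * (z * e) ≡ a * e * z
        reassoc = solve-∀
        regroup : ∀ b y y′ → y + (y′ + 2 * b * y) ≡ y′ + y * suc (2 * b)
        regroup = solve-∀

    shift-injective : Injective _≡_ _≡_ (λ d → shift a d y)
    shift-injective {d} {d′} eq = trans (sym (solve-shift d)) (trans (cong solve eq) (solve-shift d′))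

    shift-surjective : StrictlySurjective _≡_ (λ d → shift a d y)
    shift-surjective y′ = solve y′ , shift-solve y′

  -- colour c acts by the multiplier c, undone by the multiplier c · 2b ≡ - c
  translation : Fin 3 → Fin s → Fin s ↔ Fin s
  translation c d = mk↔ₛ′ (shift (toℕ c) d) (shift (toℕ c * (2 * b)) d)
    (undo (toℕ c * (2 * b)) (toℕ c) (negative+positive b (toℕ c)))
    (undo (toℕ c) (toℕ c * (2 * b)) (positive+negative b (toℕ c)))
    where
    undo : ∀ a a′ → a + a′ ≡ toℕ c * s → ∀ y → shift a′ d (shift a d y) ≡ y
    undo a a′ eq y = trans (shift-shift a a′ d y) (trans (cong (λ a″ → shift a″ d y) eq) (shift-multiple (toℕ c) d y))
    negative+positive : ∀ b c → c * (2 * b) + c ≡ c * suc (2 * b)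
    negative+positive = solve-∀
    positive+negative : ∀ b c → c + c * (2 * b) ≡ c * suc (2 * b)
    positive+negative = solve-∀

  difference-invertible : ∀ {c c′ : Fin 3} → c ≢ c′ → Invertible (toℕ c * (2 * b) + toℕ c′)
  difference-invertible {0F} {0F} c≢c′ = ⊥-elim (c≢c′ refl)
  difference-invertible {0F} {1F} _ = invertible 1 0 0 refl
  difference-invertible {0F} {2F} _ = invertible (suc b) 0 1 (witness b)
    where witness : ∀ b → 2 * suc b + 0 * suc (2 * b) ≡ 1 + 1 * suc (2 * b)
          witness = solve-∀
  difference-invertible {1F} {0F} _ = invertible (2 * b) 1 (2 * b) (witness b)
    where witness : ∀ b → (1 * (2 * b) + 0) * (2 * b) + 1 * suc (2 * b) ≡ 1 + 2 * b * suc (2 * b)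
          witness = solve-∀
  difference-invertible {1F} {1F} c≢c′ = ⊥-elim (c≢c′ refl)
  difference-invertible {1F} {2F} _ = invertible 1 0 1 (witness b)
    where witness : ∀ b → (1 * (2 * b) + 2) * 1 + 0 * suc (2 * b) ≡ 1 + 1 * suc (2 * b)
          witness = solve-∀
  difference-invertible {2F} {0F} _ = invertible b 1 (2 * b) (witness b)
    where witness : ∀ b → (2 * (2 * b) + 0) * b + 1 * suc (2 * b) ≡ 1 + 2 * b * suc (2 * b)
          witness = solve-∀
  difference-invertible {2F} {1F} _ = invertible (2 * b) 1 (4 * b) (witness b)
    where witness : ∀ b → (2 * (2 * b) + 1) * (2 * b) + 1 * suc (2 * b) ≡ 1 + 4 * b * suc (2 * b)
          witness = solve-∀
  difference-invertible {2F} {2F} c≢c′ = ⊥-elim (c≢c′ refl)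

  cyclic-orthogonalTriple : OrthogonalTriple (Fin s)
  cyclic-orthogonalTriple = record
    { π = translation
    ; difference-injective = λ {c} {c′} c≢c′ y {d} {d′} eq → shift-injective (difference-invertible c≢c′) y
        (trans (sym (shift-shift (toℕ c * (2 * b)) (toℕ c′) d y)) (trans eq (shift-shift (toℕ c * (2 * b)) (toℕ c′) d′ y)))
    ; difference-surjective = λ {c} {c′} c≢c′ y y′ →
        let (d , p) = shift-surjective (difference-invertible c≢c′) y y′
        in d , trans (shift-shift (toℕ c * (2 * b)) (toℕ c′) d y) p
    }

fourPower-orthogonalTriple : ∀ ℓ → OrthogonalTriple (Fin (4 ^ ℓ))
fourPower-orthogonalTriple zero    = Cyclic.cyclic-orthogonalTriple 0
fourPower-orthogonalTriple (suc ℓ) =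
  ↔-orthogonalTriple (↔-sym *↔×) (×-orthogonalTriple gf4-orthogonalTriple (fourPower-orthogonalTriple ℓ))

orthogonalTriple : ∀ ℓ b → OrthogonalTriple (Fin (4 ^ ℓ * (2 * b + 1)))
orthogonalTriple ℓ b = ↔-orthogonalTriple (↔-sym *↔×) (×-orthogonalTriple (fourPower-orthogonalTriple ℓ)
  (subst (OrthogonalTriple ∘ Fin) (+-comm 1 (2 * b)) (Cyclic.cyclic-orthogonalTriple b)))

record CycleFactorization (t : ℕ) {W : Set} (R : W → W → Set) (I : Set) : Set where
  field
    perm     : I → W ↔ W
    period   : ∀ i → ExactPeriod t (to (perm i))
    arc      : ∀ i w → R w (to (perm i) w)
    cover    : ∀ {w w′} → R w w′ → ∃ λ i → to (perm i) w ≡ w′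
    unique   : ∀ w {i j} → to (perm i) w ≡ to (perm j) w → i ≡ j

open CycleFactorization

conjugate : ∀ {V W : Set} → V ↔ W → W ↔ W → V ↔ V
conjugate e π = ↔-trans (↔-trans e π) (↔-sym e)

module _ {t n m : ℕ} where

  fromCtFactorization : (F : CtFactorization t n m) →
    CycleFactorization t (Arc n m) (Fin (CtFactorization.size F))
  fromCtFactorization F = record
    { perm     = λ k → ⤖⇒↔ (mk⤖ (bijective (factor k)))
    ; period   = λ k → record { returns = closes (factor k) ; not-before = minimal (factor k) }
    ; arc      = λ k → arcs-in (factor k)
    ; cover    = covers _ _
    ; unique   = λ w eq → disjoint w _ _ _ eq refl
    }
    where open CtFactorization F

  toCtFactorization : ∀ {s} → CycleFactorization t (Arc n m) (Fin s) → CtFactorization t n m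
  toCtFactorization {s} F = record
    { size     = s
    ; factor   = λ k → record
      { succ      = to (perm F k)
      ; bijective = Bijection.bijective (↔⇒⤖ (perm F k))
      ; arcs-in   = arc F k
      ; closes    = ExactPeriod.returns (period F k)
      ; minimal   = ExactPeriod.not-before (period F k)
      }
    ; covers   = λ _ _ → cover F
    ; disjoint = λ u _ _ _ p p′ → unique F u (trans p (sym p′))
    }

module _ {t : ℕ} {W I : Set} {R : W → W → Set} where

  transport : ∀ {V} {S : V → V → Set} (e : V ↔ W) →
    (∀ u u′ → S u u′ → R (to e u) (to e u′)) → (∀ u u′ → R (to e u) (to e u′) → S u u′) →
    CycleFactorization t R I → CycleFactorization t S I
  transport e S⇒R R⇒S F = record
    { perm     = λ i → conjugate e (perm F i)
    ; period   = λ i → conjugate-exactPeriod e _ (period F i)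
    ; arc      = λ i u → R⇒S u _ (subst (R (to e u)) (sym (strictlyInverseˡ e _)) (arc F i (to e u)))
    ; cover    = λ {u} {u′} r → let (i , eq) = cover F (S⇒R u u′ r) in
                   i , trans (cong (from e) eq) (strictlyInverseʳ e u′)
    ; unique   = λ u eq → unique F (to e u) (to-injective (↔-sym e) eq)
    }

  reindex : ∀ {J : Set} → J ↔ I → CycleFactorization t R I → CycleFactorization t R J
  reindex e F = record
    { perm     = perm F ∘ to e
    ; period   = period F ∘ to e
    ; arc      = arc F ∘ to e
    ; cover    = λ r → let (i , eq) = cover F r in
                   from e i , trans (cong (λ j → to (perm F j) _) (strictlyInverseˡ e i)) eq
    ; unique   = λ w eq → to-injective e (unique F w eq)
    }

  ⊎-cycleFactorization : ∀ {J} {R′ : W → W → Set} →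
    CycleFactorization t R I → CycleFactorization t R′ J → (∀ {w w′} → R w w′ → ¬ R′ w w′) →
    CycleFactorization t (λ w w′ → R w w′ ⊎ R′ w w′) (I ⊎ J)
  ⊎-cycleFactorization {J} {R′} F G R⇒¬R′ = record
    { perm = perm⊎ ; period = period′ ; arc = arc′ ; cover = cover′ ; unique = unique′ }
    where
    perm⊎ : I ⊎ J → W ↔ W
    perm⊎ (inj₁ i) = perm F i
    perm⊎ (inj₂ j) = perm G j

    period′ : ∀ k → ExactPeriod t (to (perm⊎ k))
    period′ (inj₁ i) = period F i
    period′ (inj₂ j) = period G j

    arc′ : ∀ k w → R w (to (perm⊎ k) w) ⊎ R′ w (to (perm⊎ k) w)
    arc′ (inj₁ i) w = inj₁ (arc F i w)
    arc′ (inj₂ j) w = inj₂ (arc G j w)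

    cover′ : ∀ {w w′} → R w w′ ⊎ R′ w w′ → ∃ λ k → to (perm⊎ k) w ≡ w′
    cover′ (inj₁ r) = let (i , eq) = cover F r in inj₁ i , eq
    cover′ (inj₂ r) = let (j , eq) = cover G r in inj₂ j , eq

    unique′ : ∀ w {k l} → to (perm⊎ k) w ≡ to (perm⊎ l) w → k ≡ l
    unique′ w {inj₁ i} {inj₁ i′} eq = cong inj₁ (unique F w eq)
    unique′ w {inj₁ i} {inj₂ j}  eq = ⊥-elim (R⇒¬R′ (arc F i w) (subst (R′ w) (sym eq) (arc G j w)))
    unique′ w {inj₂ j} {inj₁ i}  eq = ⊥-elim (R⇒¬R′ (arc F i w) (subst (R′ w) eq (arc G j w)))
    unique′ w {inj₂ j} {inj₂ j′} eq = cong inj₂ (unique G w eq)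

module _ {t : ℕ} {A I : Set} {R : A → A → Set} where

  ×-cycleFactorization : ∀ (B : Set) → CycleFactorization t R I →
    CycleFactorization t (λ (w w′ : A × B) → R (proj₁ w) (proj₁ w′) × proj₂ w ≡ proj₂ w′) I
  ×-cycleFactorization B F = record
    { perm   = λ i → ×-cong (perm F i) ↔-refl
    ; period = λ i → map₁-exactPeriod (period F i)
    ; arc    = λ i (a , b) → arc F i a , refl
    ; cover  = λ (r , b≡b′) → let (i , eq) = cover F r in i , cong₂ _,_ eq b≡b′
    ; unique = λ (a , b) eq → unique F a (cong proj₁ eq)
    }

  module _ {Y : Set} (F : CycleFactorization t R I) (colour : I → A → Fin 3)
           (colour-proper : ∀ i a → colour i (to (perm F i) a) ≢ colour i a)
           (T : OrthogonalTriple Y) where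

    untwist : I → Y → (A × Y) ↔ (A × Y)
    untwist i d = mk↔ₛ′ (λ (a , y) → a , from (π T (colour i a) d) y) (λ (a , z) → a , to (π T (colour i a) d) z)
      (λ (a , z) → cong (a ,_) (strictlyInverseʳ (π T (colour i a) d) z))
      (λ (a , y) → cong (a ,_) (strictlyInverseˡ (π T (colour i a) d) y))

    -- (a , y) ↦ (σ a , π T (colour i (σ a)) d (π T (colour i a) d ⁻¹ y)) with σ = to (perm F i)
    skew : I × Y → (A × Y) ↔ (A × Y)
    skew (i , d) = conjugate (untwist i d) (×-cong (perm F i) ↔-refl)

    skew-cycleFactorization : CycleFactorization t (λ (w w′ : A × Y) → R (proj₁ w) (proj₁ w′)) (I × Y)
    skew-cycleFactorization = record
      { perm   = skew
      ; period = λ (i , d) → conjugate-exactPeriod (untwist i d) _ (map₁-exactPeriod (period F i))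
      ; arc    = λ (i , d) (a , y) → arc F i a
      ; cover  = cover′
      ; unique = unique′
      }
      where
      colour-changes : ∀ i a → colour i a ≢ colour i (to (perm F i) a)
      colour-changes i a = colour-proper i a ∘ sym

      cover′ : ∀ {w w′ : A × Y} → R (proj₁ w) (proj₁ w′) → ∃ λ k → to (skew k) w ≡ w′
      cover′ {a , y} {a′ , y′} r with cover F r
      ... | i , refl = let (d , eq) = difference-surjective T (colour-changes i a) y y′ in
                       (i , d) , cong (_ ,_) eq

      unique′ : ∀ (w : A × Y) {k l} → to (skew k) w ≡ to (skew l) w → k ≡ l
      unique′ (a , y) {i , d} {i′ , d′} eq with unique F a (cong proj₁ eq)
      ... | refl = cong (i ,_) (difference-injective T (colour-changes i a) y (cong proj₂ eq))

-- The product construction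

module _ {t′ n₁ n₂ m : ℕ} (F₁ : CtFactorization (2 + t′) n₁ m) (F₂ : CtFactorization (2 + t′) n₂ m)
         (T : OrthogonalTriple (Fin n₂)) where

  private
    t : ℕ
    t = 2 + t′

    blocks : Fin (n₁ * n₂) ↔ (Fin n₁ × Fin n₂)
    blocks = *↔×

    split : Vertex (n₁ * n₂) m ↔ (Vertex n₁ m × Fin n₂)
    split = mk↔ₛ′ (λ (p , x) → let (i , y) = to blocks p in (i , x) , y) (λ ((i , x) , y) → from blocks (i , y) , x)
      (λ ((i , x) , y) → cong (λ (i , y) → (i , x) , y) (strictlyInverseˡ blocks (i , y)))
      (λ (p , x) → cong (_, x) (strictlyInverseʳ blocks p))

    swap : (Vertex n₁ m × Fin n₂) ↔ (Vertex n₂ m × Fin n₁)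
    swap = mk↔ₛ′ (λ ((i , x) , y) → (y , x) , i) (λ ((y , x) , i) → (i , x) , y) (λ _ → refl) (λ _ → refl)

    BetweenBlocks WithinBlock : Vertex n₁ m × Fin n₂ → Vertex n₁ m × Fin n₂ → Set
    BetweenBlocks ((i , _) , _) ((i′ , _) , _) = i ≢ i′
    WithinBlock ((i , _) , y) ((i′ , _) , y′) = y ≢ y′ × i ≡ i′

    code : Vertex n₁ m → ℕ
    code = toℕ ∘ from *↔×

    code-injective : ∀ {a a′} → code a ≡ code a′ → a ≡ a′
    code-injective = to-injective (↔-sym *↔×) ∘ toℕ-injective

    G₁ : CycleFactorization t (Arc n₁ m) (Fin (CtFactorization.size F₁))
    G₁ = fromCtFactorization F₁

    G₂ : CycleFactorization t (Arc n₂ m) (Fin (CtFactorization.size F₂))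
    G₂ = fromCtFactorization F₂

    module Colouring k = ThreeColouring code code-injective (CycleFactorization.period G₁ k)

    betweenBlocks : CycleFactorization t BetweenBlocks (Fin (CtFactorization.size F₁) × Fin n₂)
    betweenBlocks = skew-cycleFactorization G₁ Colouring.colour Colouring.colour-proper T

    withinBlock : CycleFactorization t WithinBlock (Fin (CtFactorization.size F₂))
    withinBlock = transport swap (λ _ _ r → r) (λ _ _ r → r) (×-cycleFactorization (Fin n₁) G₂)

    Block : Vertex n₁ m × Fin n₂ → Vertex n₁ m × Fin n₂ → Set
    Block w w′ = BetweenBlocks w w′ ⊎ WithinBlock w w′

    arc⇒block : ∀ u u′ → Arc (n₁ * n₂) m u u′ → Block (to split u) (to split u′)
    arc⇒block (p , _) (p′ , _) p≢p′ with proj₁ (to blocks p) ≟ proj₁ (to blocks p′)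
    ... | no  i≢i′ = inj₁ i≢i′
    ... | yes i≡i′ = inj₂ ((λ y≡y′ → p≢p′ (to-injective blocks (cong₂ _,_ i≡i′ y≡y′))) , i≡i′)

    block⇒arc : ∀ u u′ → Block (to split u) (to split u′) → Arc (n₁ * n₂) m u u′
    block⇒arc _ _ (inj₁ i≢i′)       p≡p′ = i≢i′ (cong (proj₁ ∘ to blocks) p≡p′)
    block⇒arc _ _ (inj₂ (y≢y′ , _)) p≡p′ = y≢y′ (cong (proj₂ ∘ to blocks) p≡p′)

    index : Fin (CtFactorization.size F₁ * n₂ + CtFactorization.size F₂) ↔
            ((Fin (CtFactorization.size F₁) × Fin n₂) ⊎ Fin (CtFactorization.size F₂))
    index = ↔-trans +↔⊎ (⊎-cong *↔× ↔-refl)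

  product-ctFactorization : CtFactorization t (n₁ * n₂) m
  product-ctFactorization =
    toCtFactorization (reindex index (transport split arc⇒block block⇒arc
      (⊎-cycleFactorization betweenBlocks withinBlock (λ i≢i′ (_ , i≡i′) → i≢i′ i≡i′))))

lemma6p1 : (t n₁ n₂ : ℕ) → 3 ≤ t → (Σ ℕ λ a → t ≡ 2 * a + 1) → 3 ≤ n₁ →
    (Σ ℕ λ ℓ → Σ ℕ λ b → n₂ ≡ 4 ^ ℓ * (2 * b + 1)) →
    HasCtFactorization t n₁ t → HasCtFactorization t n₂ t →
    HasCtFactorization t (n₁ * n₂) t
lemma6p1 t n₁ n₂ (s≤s (s≤s (s≤s _))) _ _ (ℓ , b , refl) F₁ F₂ =
  product-ctFactorization F₁ F₂ (orthogonalTriple ℓ b)
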